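{- Let $p$ be a prime and let $a,b$ be integers such that $an+b \in \mathbb{N}=\{1,2,\ldots\}$ for all $n\ge 0$; let $A = \{an+b : n \geq 0\}$ and $R(A) = \{x/y : x,y \in A\}$. (a) If $p \nmid a$, then $R(A)$ is dense in $\mathbb{Q}_p$. (b) If $p \mid a$ and $p \nmid b$, then $R(A)$ is not dense in $\mathbb{Q}_p$.
   Context: $\mathbb{Q}_p$ denotes the field of $p$-adic numbers with the $p$-adic metric. -}

module Defs where

open import Data.Nat using (ℕ; zero; suc; _^_)
open import Data.Integer using (ℤ; +_; -[1+_]; -_; _*_; _+_)
open import Data.Integer.Divisibility using (_∣_)
open import Data.Rational using (ℚ; _/_; 0ℚ; _-_)
open import Data.Product using (∃; ∃-syntax; _×_)
open import Relation.Binary.PropositionalEquality using (_≡_)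

-- The rational number x / y for integers x, y (y ≠ 0).
-- Junk value 0 when y = 0 (never used: all denominators below are ≥ 1).
_÷ℤ_ : ℤ → ℤ → ℚ
x ÷ℤ (+ zero)   = 0ℚ
x ÷ℤ (+ suc n)  = x / suc n
x ÷ℤ -[1+ n ]   = (- x) / suc n

-- p-adic closeness on ℚ: |r - s|_p ≤ p^(-k), i.e. p^k divides the
-- numerator of r - s written in lowest terms (true when r = s).
pClose : ℕ → ℕ → ℚ → ℚ → Set
pClose p k r s = (+ (p ^ k)) ∣ ℚ.numerator (r - s)

-- A set S ⊆ ℚ is dense in ℚ_p: every p-adic ball around every rational
-- (equivalently, since ℚ is dense in ℚ_p, around every point of ℚ_p)
-- contains a point of S.
DenseInQp : ℕ → (ℚ → Set) → Set
DenseInQp p S = ∀ (q : ℚ) (k : ℕ) → ∃[ r ] (S r × pClose p k r q)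

AP : ℤ → ℤ → ℤ → Set
AP a b x = ∃[ n ] (x ≡ a * + n + b)

RatioSet : ℤ → ℤ → ℚ → Set
RatioSet a b r = ∃[ x ] ∃[ y ] (AP a b x × AP a b y × r ≡ x ÷ℤ y)

{-# OPTIONS --safe #-}
module Submission where

-- (a) As p ∤ a, a is a unit modulo every power P of p, so a n + b meets every residue class
-- modulo P.  Given q = u / v and k, pick x ≡ u and y ≡ v (mod P).  Then
-- x / y - q = (x v - u y) / (y v) with P ∣ x v - u y, while neither v nor y is divisible by
-- p ^ (1 + v) (as v < p ^ (1 + v), and y ≡ v).  Hence p ^ k divides the numerator of
-- x / y - q as soon as P = p ^ (1 + v + (v + k)).
-- (b) If p ∣ a and p ∤ b, then p divides no element of A, so the numerator of every x / y in
-- R(A) is prime to p, and R(A) misses the ball of radius 1 / p around 0.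

open import Data.Nat.Base using (ℕ; zero; suc; NonZero)
open import Data.Nat.Primality using (Prime)
open import Data.Product using (_×_; _,_; ∃-syntax)
open import Relation.Nullary using (¬_; yes; no; contradiction)
open import Relation.Binary.PropositionalEquality

module PrimePowerDivisibility {p : ℕ} (p-prime : Prime p) where

  open import Data.Nat.Base using (_+_; _*_; _^_; _<_; nonTrivial⇒n>1; z<s)
  open import Data.Nat.Properties
    using (*-comm; *-assoc; *-identityʳ; ^-distribˡ-+-*; m^n≢0; m<m*n; n<1+n; <-trans; ≤-<-trans; <⇒≱)
  open import Data.Nat.Divisibility
  open import Data.Nat.Coprimality as Coprime using (Coprime; coprime-divisor)
  open import Data.Nat.Primality using (prime⇒nonZero; prime⇒nonTrivial; prime⇒irreducible)
  open import Data.Sum using (inj₁; inj₂)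

  instance
    p≢0 : NonZero p
    p≢0 = prime⇒nonZero p-prime

  ∤⇒coprime : ∀ {m} → p ∤ m → Coprime m p
  ∤⇒coprime p∤m (d∣m , d∣p) with prime⇒irreducible p-prime d∣p
  ... | inj₁ d≡1  = d≡1
  ... | inj₂ refl = contradiction d∣m p∤m

  ∤⇒coprime-^ : ∀ {m} → p ∤ m → ∀ k → Coprime m (p ^ k)
  ∤⇒coprime-^ p∤m zero    (_   , d∣1)      = ∣1⇒≡1 d∣1
  ∤⇒coprime-^ p∤m (suc k) (d∣m , d∣p*p^k) =
    ∤⇒coprime-^ p∤m k (d∣m , coprime-divisor d⊥p d∣p*p^k)
    where
    d⊥p : Coprime _ p
    d⊥p (e∣d , e∣p) = ∤⇒coprime p∤m (∣-trans e∣d d∣m , e∣p)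

  n<p^n : ∀ n → n < p ^ n
  n<p^n zero    = z<s
  n<p^n (suc n) =
    subst (suc n <_) (*-comm (p ^ n) p) (≤-<-trans (n<p^n n) (m<m*n (p ^ n) p 1<p))
    where
    instance _ = m^n≢0 p n
    1<p : 1 < p
    1<p = nonTrivial⇒n>1 p {{prime⇒nonTrivial p-prime}}

  p^[1+n]∤n : ∀ n .{{_ : NonZero n}} → p ^ suc n ∤ n
  p^[1+n]∤n n p^[1+n]∣n = <⇒≱ (<-trans (n<1+n n) (n<p^n (suc n))) (∣⇒≤ p^[1+n]∣n)

  p^j∣p^[j+k] : ∀ j k → p ^ j ∣ p ^ (j + k)
  p^j∣p^[j+k] j k = subst (p ^ j ∣_) (sym (^-distribˡ-+-* p j k)) (m∣m*n (p ^ k))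

  p^k∣p^[j+k] : ∀ j k → p ^ k ∣ p ^ (j + k)
  p^k∣p^[j+k] j k = subst (p ^ k ∣_) (sym (^-distribˡ-+-* p j k)) (n∣m*n (p ^ j))

  p^[j+k]∣m*n⇒p^k∣m : ∀ j k {m n} → p ^ (j + k) ∣ m * n → p ^ suc j ∤ n → p ^ k ∣ m
  p^[j+k]∣m*n⇒p^k∣m j k {m} {n} p^[j+k]∣mn p^[1+j]∤n with p ∣? n
  ... | no p∤n = ∣-trans (p^k∣p^[j+k] j k) (coprime-divisor p^[j+k]⊥n p^[j+k]∣nm)
    where
    p^[j+k]⊥n : Coprime (p ^ (j + k)) n
    p^[j+k]⊥n = Coprime.sym (∤⇒coprime-^ p∤n (j + k))
    p^[j+k]∣nm : p ^ (j + k) ∣ n * m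
    p^[j+k]∣nm = subst (p ^ (j + k) ∣_) (*-comm m n) p^[j+k]∣mn
  p^[j+k]∣m*n⇒p^k∣m zero    k p^k∣mn p^1∤n | yes p∣n =
    contradiction (subst (_∣ _) (sym (*-identityʳ p)) p∣n) p^1∤n
  p^[j+k]∣m*n⇒p^k∣m (suc j) k {m} p^[2+j+k]∣m*cp p^[2+j]∤cp | yes (divides-refl c) =
    p^[j+k]∣m*n⇒p^k∣m j k p^[j+k]∣mc p^[1+j]∤c
    where
    m*[c*p]≡p*[m*c] : m * (c * p) ≡ p * (m * c)
    m*[c*p]≡p*[m*c] = trans (sym (*-assoc m c p)) (*-comm (m * c) p)
    p^[j+k]∣mc : p ^ (j + k) ∣ m * c
    p^[j+k]∣mc = *-cancelˡ-∣ p (subst (p ^ suc (j + k) ∣_) m*[c*p]≡p*[m*c] p^[2+j+k]∣m*cp)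
    p^[1+j]∤c : p ^ suc j ∤ c
    p^[1+j]∤c p^[1+j]∣c =
      p^[2+j]∤cp (subst (p ^ suc (suc j) ∣_) (*-comm p c) (*-monoʳ-∣ p p^[1+j]∣c))

import Data.Nat.Base as ℕ
import Data.Nat.Coprimality as ℕ
import Data.Nat.Divisibility as ℕ
import Data.Nat.Properties as ℕ
open import Data.Nat.GCD using (module Bézout)
open import Data.Nat.Base using (_^_)
open import Data.Integer.Base using (ℤ; +_; -[1+_]; _+_; _*_; _-_; -_; 1ℤ; ∣_∣; _≤_; +≤+; _%ℕ_; _/ℕ_)
import Data.Integer.Properties as ℤ
import Data.Integer.Coprimality as ℤ
open import Data.Integer.GCD using (gcd)
open import Data.Integer.DivMod using (a≡a%ℕn+[a/ℕn]*n)
open import Data.Integer.Divisibility using (_∣_)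
open import Data.Integer.Divisibility.Signed
  using (divides; ∣-refl; ∣-trans; ∣m⇒∣m*n; ∣n⇒∣m*n; ∣m∣n⇒∣m-n; ∣m+n∣m⇒∣n; ∣⇒∣ᵤ; ∣ᵤ⇒∣)
  renaming (_∣_ to _∣ₛ_)
open import Data.Integer.Tactic.RingSolver using (solve)
open import Data.List.Base using (_∷_; [])
open import Data.Rational.Base as ℚ using (↥_; ↧_; ↧ₙ_; _/_; 0ℚ; toℚᵘ; fromℚᵘ)
open import Data.Rational.Properties using (↥-/; +-identityʳ; toℚᵘ-homo-+; toℚᵘ-homo‿-; toℚᵘ-fromℚᵘ)
open import Data.Rational.Unnormalised.Base as ℚᵘ using (mkℚᵘ; _≃_)
import Data.Rational.Unnormalised.Properties as ℚᵘ
open ≡-Reasoning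

open import Defs

coprime⇒inverse⁺ : ∀ {m n} → ℕ.Coprime m n → ∃[ s ] (+ n ∣ₛ + m * s - 1ℤ)
coprime⇒inverse⁺ {m} {n} m⊥n = bézout⇒inverse (ℕ.coprime-Bézout m⊥n)
  where
  toℤ : ∀ i j k l → 1 ℕ.+ i ℕ.* j ≡ k ℕ.* l → 1ℤ + + i * + j ≡ + k * + l
  toℤ i j k l e = trans (cong (λ z → 1ℤ + z) (sym (ℤ.pos-* i j))) (trans (cong +_ e) (ℤ.pos-* k l))

  +-case : ∀ M N X Y → 1ℤ + Y * N ≡ X * M → M * X - 1ℤ ≡ Y * N
  +-case M N X Y 1+YN≡XM = begin
    M * X - 1ℤ        ≡⟨ solve (M ∷ X ∷ []) ⟩
    X * M - 1ℤ        ≡⟨ cong (_- 1ℤ) 1+YN≡XM ⟨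
    1ℤ + Y * N - 1ℤ   ≡⟨ solve (Y ∷ N ∷ []) ⟩
    Y * N             ∎

  -+-case : ∀ M N X Y → 1ℤ + X * M ≡ Y * N → M * - X - 1ℤ ≡ - Y * N
  -+-case M N X Y 1+XM≡YN = begin
    M * - X - 1ℤ      ≡⟨ solve (M ∷ X ∷ []) ⟩
    - (1ℤ + X * M)    ≡⟨ cong -_ 1+XM≡YN ⟩
    - (Y * N)         ≡⟨ solve (Y ∷ N ∷ []) ⟩
    - Y * N           ∎

  bézout⇒inverse : Bézout.Identity 1 m n → ∃[ s ] (+ n ∣ₛ + m * s - 1ℤ)
  bézout⇒inverse (Bézout.+- x y 1+yn≡xm) =
    + x , divides (+ y) (+-case (+ m) (+ n) (+ x) (+ y) (toℤ y n x m 1+yn≡xm))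
  bézout⇒inverse (Bézout.-+ x y 1+xm≡yn) =
    - + x , divides (- + y) (-+-case (+ m) (+ n) (+ x) (+ y) (toℤ x m y n 1+xm≡yn))

coprime⇒inverse : ∀ a {n} → ℤ.Coprime a (+ n) → ∃[ s ] (+ n ∣ₛ a * s - 1ℤ)
coprime⇒inverse (+ m)    m⊥n = coprime⇒inverse⁺ m⊥n
coprime⇒inverse -[1+ m ] m⊥n with coprime⇒inverse⁺ m⊥n
... | s , n∣ms-1 = - s , subst (+ _ ∣ₛ_) (neg-cancel (+ suc m) s) n∣ms-1
  where
  neg-cancel : ∀ a s → a * s - 1ℤ ≡ - a * - s - 1ℤ
  neg-cancel a s = solve (a ∷ s ∷ [])

affine-congruence-solvable : ∀ n .{{_ : NonZero n}} a → ℤ.Coprime a (+ n) →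
                             ∀ b t → ∃[ i ] (+ n ∣ₛ a * + i + b - t)
affine-congruence-solvable n a a⊥n b t with coprime⇒inverse a a⊥n
... | s , n∣as-1 =
  i , subst (+ n ∣ₛ_) (sym eq) (∣m∣n⇒∣m-n (∣m⇒∣m*n (t - b) n∣as-1) (∣n⇒∣m*n (a * w) ∣-refl))
  where
  z = s * (t - b)
  i = z %ℕ n
  w = z /ℕ n
  reassoc : ∀ a i w N b t s → i + w * N ≡ s * (t - b) →
            a * i + b - t ≡ (a * s - 1ℤ) * (t - b) - a * w * N
  reassoc a i w N b t s i+wN≡z = begin
    a * i + b - t                          ≡⟨ solve (a ∷ i ∷ w ∷ N ∷ b ∷ t ∷ []) ⟩
    a * (i + w * N) + b - t - a * w * N    ≡⟨ cong (λ u → a * u + b - t - a * w * N) i+wN≡z ⟩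
    a * (s * (t - b)) + b - t - a * w * N  ≡⟨ solve (a ∷ s ∷ w ∷ N ∷ b ∷ t ∷ []) ⟩
    (a * s - 1ℤ) * (t - b) - a * w * N     ∎
  eq : a * + i + b - t ≡ (a * s - 1ℤ) * (t - b) - a * w * + n
  eq = reassoc a (+ i) w (+ n) b t s (sym (a≡a%ℕn+[a/ℕn]*n z n))

∣x-u∧∣y-v⇒∣xv-uy : ∀ {P} x u y v → P ∣ₛ x - u → P ∣ₛ y - v → P ∣ₛ x * v - u * y
∣x-u∧∣y-v⇒∣xv-uy {P} x u y v P∣x-u P∣y-v =
  subst (P ∣ₛ_) (regroup x u y v) (∣m∣n⇒∣m-n (∣m⇒∣m*n v P∣x-u) (∣n⇒∣m*n u P∣y-v))
  where
  regroup : ∀ x u y v → (x - u) * v - u * (y - v) ≡ x * v - u * y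
  regroup x u y v = solve (x ∷ u ∷ y ∷ v ∷ [])

↥[ρ-q]-cross : ∀ ρ q → ↥ (fromℚᵘ ρ ℚ.- q) * (ℚᵘ.↧ ρ * ↧ q)
                     ≡ (ℚᵘ.↥ ρ * ↧ q - ↥ q * ℚᵘ.↧ ρ) * ↧ (fromℚᵘ ρ ℚ.- q)
↥[ρ-q]-cross ρ@record{} q@record{} = begin
  ↥ r * (ℚᵘ.↧ ρ * ↧ q)                   ≡⟨ cong (↥ r *_) (ℤ.pos-* (ℚᵘ.↧ₙ ρ) (↧ₙ q)) ⟨
  ↥ r * ℚᵘ.↧ (ρ ℚᵘ.- toℚᵘ q)             ≡⟨ drop-*≡* r toℚᵘ[r]≃ρ-q ⟩
  (ℚᵘ.↥ ρ * ↧ q + - ↥ q * ℚᵘ.↧ ρ) * ↧ r  ≡⟨ cong (λ z → (ℚᵘ.↥ ρ * ↧ q + z) * ↧ r) (ℤ.neg-distribˡ-* (↥ q) (ℚᵘ.↧ ρ)) ⟨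
  (ℚᵘ.↥ ρ * ↧ q - ↥ q * ℚᵘ.↧ ρ) * ↧ r    ∎
  where
  r = fromℚᵘ ρ ℚ.- q
  toℚᵘ[r]≃ρ-q : toℚᵘ r ≃ ρ ℚᵘ.- toℚᵘ q
  toℚᵘ[r]≃ρ-q = ℚᵘ.≃-trans (toℚᵘ-homo-+ (fromℚᵘ ρ) (ℚ.- q))
                            (ℚᵘ.+-cong (toℚᵘ-fromℚᵘ ρ) (toℚᵘ-homo‿- q))
  drop-*≡* : ∀ r {σ} → toℚᵘ r ≃ σ → ↥ r * ℚᵘ.↧ σ ≡ ℚᵘ.↥ σ * ↧ r
  drop-*≡* record{} = ℚᵘ.drop-*≡*

↥[x÷ℤy]∣x : ∀ x {y} → + 1 ≤ y → ↥ (x ÷ℤ y) ∣ₛ x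
↥[x÷ℤy]∣x x {+ suc m} _ = divides g (trans (sym (↥-/ x (suc m))) (ℤ.*-comm (↥ (x / suc m)) g))
  where g = gcd x (+ suc m)
↥[x÷ℤy]∣x x {+ zero}  (+≤+ ())

module _ {p : ℕ} (p-prime : Prime p) where

  open PrimePowerDivisibility p-prime

  congruent⇒pClose : ∀ j k x {y} q → + 1 ≤ y → ¬ + (p ^ suc j) ∣ ↧ q →
                     + (p ^ (suc j ℕ.+ (j ℕ.+ k))) ∣ₛ x - ↥ q →
                     + (p ^ (suc j ℕ.+ (j ℕ.+ k))) ∣ₛ y - ↧ q →
                     pClose p k (x ÷ℤ y) q
  congruent⇒pClose j k x {+ zero}  q (+≤+ ())
  congruent⇒pClose j k x {+ suc m} q _ p^[1+j]∤v P∣x-u P∣y-v =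
    p^[j+k]∣m*n⇒p^k∣m j k (p^[j+k]∣m*n⇒p^k∣m j (j ℕ.+ k) p^[2j+k]∣N*y*v p^[1+j]∤v) p^[1+j]∤y
    where
    y = + suc m
    v = ↧ q
    N = ↥ (x / suc m ℚ.- q)
    P = + (p ^ (suc j ℕ.+ (j ℕ.+ k)))

    P∣N*[y*v] : P ∣ₛ N * (y * v)
    P∣N*[y*v] = subst (P ∣ₛ_) (sym (↥[ρ-q]-cross (mkℚᵘ x m) q))
                  (∣m⇒∣m*n (↧ (x / suc m ℚ.- q)) (∣x-u∧∣y-v⇒∣xv-uy x (↥ q) y v P∣x-u P∣y-v))

    ∣N*[y*v]∣≡∣N∣*y*v : ∣ N * (y * v) ∣ ≡ ∣ N ∣ ℕ.* suc m ℕ.* ↧ₙ q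
    ∣N*[y*v]∣≡∣N∣*y*v = trans (ℤ.abs-* N (y * v))
      (trans (cong (∣ N ∣ ℕ.*_) (ℤ.abs-* y v)) (sym (ℕ.*-assoc ∣ N ∣ (suc m) (↧ₙ q))))

    p^[2j+k]∣N*y*v : p ^ (j ℕ.+ (j ℕ.+ k)) ℕ.∣ ∣ N ∣ ℕ.* suc m ℕ.* ↧ₙ q
    p^[2j+k]∣N*y*v = ℕ.∣-trans (p^k∣p^[j+k] 1 (j ℕ.+ (j ℕ.+ k)))
                       (subst (_ ℕ.∣_) ∣N*[y*v]∣≡∣N∣*y*v (∣⇒∣ᵤ P∣N*[y*v]))

    p^[1+j]∤y : ¬ + (p ^ suc j) ∣ y
    p^[1+j]∤y p^[1+j]∣y = p^[1+j]∤v (∣⇒∣ᵤ (subst (+ (p ^ suc j) ∣ₛ_) (y-[y-v]≡v y v)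
      (∣m∣n⇒∣m-n (∣ᵤ⇒∣ {i = y} p^[1+j]∣y) (∣-trans (∣ᵤ⇒∣ {i = P} (p^j∣p^[j+k] (suc j) (j ℕ.+ k))) P∣y-v))))
      where
      y-[y-v]≡v : ∀ y v → y - (y - v) ≡ v
      y-[y-v]≡v y v = solve (y ∷ v ∷ [])

  RatioSet-dense : ∀ a b → (∀ n → + 1 ≤ a * + n + b) → ¬ + p ∣ a → DenseInQp p (RatioSet a b)
  RatioSet-dense a b A-positive p∤a q k = close (hit (↥ q)) (hit (↧ q))
    where
    v = ↧ₙ q
    K = suc v ℕ.+ (v ℕ.+ k)
    instance _ = ℕ.m^n≢0 p K

    hit : ∀ t → ∃[ i ] (+ (p ^ K) ∣ₛ a * + i + b - t)
    hit = affine-congruence-solvable (p ^ K) a (∤⇒coprime-^ p∤a K) b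

    close : ∃[ i ] (+ (p ^ K) ∣ₛ a * + i + b - ↥ q) → ∃[ l ] (+ (p ^ K) ∣ₛ a * + l + b - ↧ q) →
            ∃[ r ] (RatioSet a b r × pClose p k r q)
    close (i , P∣x-u) (l , P∣y-v) =
      _ , (_ , _ , (i , refl) , (l , refl) , refl) ,
      congruent⇒pClose v k _ q (A-positive l) (p^[1+n]∤n v) P∣x-u P∣y-v

  RatioSet-not-dense : ∀ a b → (∀ n → + 1 ≤ a * + n + b) → + p ∣ a → ¬ + p ∣ b →
                       ¬ DenseInQp p (RatioSet a b)
  RatioSet-not-dense a b A-positive p∣a p∤b dense with dense 0ℚ 1
  ... | _ , (_ , _ , (i , refl) , (l , refl) , refl) , p^1∣↥[r-0] = p∤b (∣⇒∣ᵤ p∣b)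
    where
    x = a * + i + b
    r = x ÷ℤ (a * + l + b)
    p∣↥r : + p ∣ ↥ r
    p∣↥r = subst₂ (λ d s → d ℕ.∣ ∣ ↥ s ∣) (ℕ.*-identityʳ p) (+-identityʳ r) p^1∣↥[r-0]
    p∣x : + p ∣ₛ x
    p∣x = ∣-trans (∣ᵤ⇒∣ {i = ↥ r} p∣↥r) (↥[x÷ℤy]∣x x (A-positive l))
    p∣b : + p ∣ₛ b
    p∣b = ∣m+n∣m⇒∣n {m = a * + i} p∣x (∣m⇒∣m*n (+ i) (∣ᵤ⇒∣ {i = a} p∣a))

lemma2p4 : (p : ℕ) → Prime p → (a b : ℤ) →
    (∀ (n : ℕ) → + 1 ≤ a * + n + b) →
    ((¬ (+ p ∣ a)) → DenseInQp p (RatioSet a b))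
    × ((+ p ∣ a) → ¬ (+ p ∣ b) → ¬ DenseInQp p (RatioSet a b))
lemma2p4 p p-prime a b A-positive =
  RatioSet-dense p-prime a b A-positive , RatioSet-not-dense p-prime a b A-positive
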